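{- For all $n\ge 1$ and $k\ge 0$, if the polynomial $A_{n,k}(q)$ is nonzero then it is symmetric.
   Context: For a permutation $\sigma=b_1\ldots b_n$, $\mathrm{des}\,\sigma=\#\{i:b_i>b_{i+1}\}$ and $\mathrm{maj}\,\sigma=\sum_{b_i>b_{i+1}}i$. $\mathrm{Av}_n(321)$ is the set of permutations of $[n]$ with no $i<j<k$ such that $b_i>b_j>b_k$. Let $A_{n,k}(q)=\sum q^{\mathrm{maj}\,\sigma}$, the sum over all $\sigma\in\mathrm{Av}_n(321)$ with $\mathrm{des}\,\sigma=k$ (i.e. the coefficient of $t^k$ in $\sum_{\sigma\in\mathrm{Av}_n(321)}q^{\mathrm{maj}\,\sigma}t^{\mathrm{des}\,\sigma}$). A nonzero polynomial $f(x)=\sum_{i=r}^s a_ix^i$ with $a_r\neq0$, $a_s\neq0$ is symmetric if $a_i=a_j$ whenever $i+j=r+s$. -}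

module Defs where

open import Data.Nat using (ℕ; zero; suc; _+_; _<ᵇ_; _≡ᵇ_; _<_)
open import Data.Bool using (Bool; true; false; _∧_; _∨_; not; if_then_else_)
open import Data.List using (List; []; _∷_; concatMap; map; length; filter)
open import Data.Bool.ListAction using (any)
open import Data.Product using (∃)
open import Relation.Binary.PropositionalEquality using (_≡_; _≢_)
open import Relation.Nullary.Decidable using (yes; no)
open import Data.Bool.Properties using () renaming (_≟_ to _≟ᵇ_)

-- Permutations of [n] = {1,…,n} in one-line notation b₁…bₙ, as lists.
-- All ways of inserting x into a list.
insertions : ℕ → List ℕ → List (List ℕ)
insertions x []       = (x ∷ []) ∷ []
insertions x (y ∷ ys) = (x ∷ y ∷ ys) ∷ map (y ∷_) (insertions x ys)

perms : ℕ → List (List ℕ)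
perms zero    = [] ∷ []
perms (suc n) = concatMap (insertions (suc n)) (perms n)

des : List ℕ → ℕ
des []           = 0
des (x ∷ [])     = 0
des (x ∷ y ∷ ys) = (if y <ᵇ x then 1 else 0) + des (y ∷ ys)

majFrom : ℕ → List ℕ → ℕ
majFrom i []           = 0
majFrom i (x ∷ [])     = 0
majFrom i (x ∷ y ∷ ys) = (if y <ᵇ x then i else 0) + majFrom (suc i) (y ∷ ys)

maj : List ℕ → ℕ
maj = majFrom 1

has21Below : ℕ → List ℕ → Bool
has21Below x []       = false
has21Below x (y ∷ ys) = ((y <ᵇ x) ∧ any (λ z → z <ᵇ y) ys) ∨ has21Below x ys

contains321 : List ℕ → Bool
contains321 []       = false
contains321 (x ∷ xs) = has21Below x xs ∨ contains321 xs

Av321 : ℕ → List (List ℕ)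
Av321 n = filter (λ σ → not (contains321 σ) ≟ᵇ true) (perms n)

-- Coefficient of q^m in A_{n,k}(q) = Σ_{σ ∈ Av_n(321), des σ = k} q^{maj σ}
A-coeff : ℕ → ℕ → ℕ → ℕ
A-coeff n k m =
  length (filter (λ σ → ((des σ ≡ᵇ k) ∧ (maj σ ≡ᵇ m)) ≟ᵇ true) (Av321 n))

Nonzero : (ℕ → ℕ) → Set
Nonzero f = ∃ λ i → f i ≢ 0

-- Symmetric, as in the paper: with r the lowest and s the highest index of a
-- nonzero coefficient, a_i = a_j whenever i + j = r + s.
Symmetric : (ℕ → ℕ) → Set
Symmetric f =
  (r s : ℕ) → f r ≢ 0 → f s ≢ 0 →
  (∀ i → i < r → f i ≡ 0) → (∀ i → s < i → f i ≡ 0) →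
  ∀ i j → i + j ≡ r + s → f i ≡ f j

module Submission where

-- For N = n + 1 the reverse-complement  rc σ = (N−bₙ)…(N−b₁)  is an involution
-- of the permutations of [n].  Read backwards and complemented, a pattern
-- a > b > c is again a 321 pattern, so rc maps Av_n(321) onto itself.  It turns
-- a descent at position i into a descent at position n − i (the descent word is
-- reversed), hence  des (rc σ) = des σ  and  maj (rc σ) + maj σ = n · des σ.
-- Counting Av_n(321) along rc therefore gives, with T = n·k,
--   A-coeff n k m = A-coeff n k (T − m)  for m ≤ T,   A-coeff n k m = 0  for m > T,
-- and every coefficient sequence with this reflection symmetry is symmetric.

open import Defs
open import Function using (_∘_; flip; _⇔_; mk⇔; Equivalence)
open import Data.Empty using (⊥-elim)
open import Data.Unit using (tt)
open import Data.Product using (_×_; _,_; proj₁; proj₂; ∃; ∃₂; map₂)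
open import Data.Sum using (inj₁; inj₂)
open import Data.Bool using (Bool; true; false; T; not; _∧_; if_then_else_)
open import Data.Bool.Properties using (T-∨; T-∧; T-≡) renaming (_≟_ to _≟ᵇ_)
open import Data.Nat using (ℕ; zero; suc; _+_; _*_; _∸_; _≤_; _<_; _≥_; _<ᵇ_; _≡ᵇ_; s≤s; z≤n)
open import Data.Nat.Properties
  using ( _≟_; _<?_; ≤-refl; ≤-trans; ≤-antisym; ≤-reflexive; <-irrefl; <-≤-trans; <⇒≤; <⇒≱; ≮⇒≥
        ; m≤n⇒m≤1+n; ≤∧≢⇒<; +-assoc; +-suc; +-identityʳ; ≤-pred; m≤m+n; m≤n+m; +-monoˡ-≤; +-monoʳ-≤
        ; m<n⇒0<n∸m; ∸-monoʳ-<; ∸-monoʳ-≤; m∸[m∸n]≡n; m+n∸m≡n; m+n∸n≡m; m∸n+n≡m; m+[n∸m]≡n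
        ; <ᵇ⇒<; <⇒<ᵇ; <ᵇ-reflects-<; ≡ᵇ⇒≡; ≡⇒≡ᵇ )
open import Data.Nat.ListAction using (sum)
open import Data.Nat.ListAction.Properties using (sum-↭)
open import Data.Nat.Tactic.RingSolver using (solve-∀)
open import Data.List using (List; []; _∷_; _++_; _∷ʳ_; map; filter; length; reverse; concatMap)
open import Data.List.Properties
  using (∷-injectiveˡ; ∷-injectiveʳ; map-∘; map-id-local; filter-≐; filter-none; unfold-reverse; length-reverse; reverse-map; reverse-involutive)
open import Data.List.Membership.Propositional using (_∈_; _∉_; find; lose)
open import Data.List.Membership.Propositional.Properties
  using (∈-map⁺; ∈-map⁻; ∈-filter⁺; ∈-filter⁻; ∈-∃++; ∈-concatMap⁺; ∈-concatMap⁻)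
open import Data.List.Membership.Propositional.Properties.WithK using (unique∧set⇒bag)
open import Data.List.Relation.Unary.Any using (here; there)
open import Data.List.Relation.Unary.Any.Properties using (any⁺; any⁻)
open import Data.List.Relation.Unary.All as All using (All; []; _∷_)
open import Data.List.Relation.Unary.Unique.Propositional using (Unique; []; _∷_)
import Data.List.Relation.Unary.Unique.Propositional.Properties as Unique
open import Data.List.Relation.Binary.BagAndSetEquality using (∼bag⇒↭; _∼[_]_; set)
open import Data.List.Relation.Binary.Permutation.Propositional using (_↭_; ↭-refl; ↭-sym; ↭-trans; ↭-prep; ↭-swap)
open import Data.List.Relation.Binary.Permutation.Propositional.Properties
  using (↭-length; ↭-reverse; ∈-resp-↭; drop-mid; ↭-empty-inv; filter-↭) renaming (map⁺ to ↭-map⁺)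
open import Data.List.Relation.Binary.Sublist.Propositional using (_⊆_; _∷_; from∈; to∈) renaming (_∷ʳ_ to skip)
open import Data.List.Relation.Binary.Sublist.Propositional.Properties using (reverse⁺; All-resp-⊆) renaming (map⁺ to ⊆-map⁺)
open import Relation.Nullary using (¬_; yes; no; contradiction)
open import Relation.Nullary.Decidable using (_×-dec_)
open import Relation.Nullary.Reflects using (det; fromEquivalence)
open import Relation.Unary using (Pred; Decidable; _≐_)
open import Relation.Binary.PropositionalEquality using (_≡_; _≢_; refl; sym; trans; cong; cong₂; subst; module ≡-Reasoning)

open Equivalence using (to; from)

module _ {A : Set} where

  involution-↭ : {L : List A} (g : A → A) → Unique L →
                 (∀ {x} → x ∈ L → g x ∈ L) → (∀ {x} → x ∈ L → g (g x) ≡ x) →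
                 map g L ↭ L
  involution-↭ {L} g uniqueL into involutive =
    ∼bag⇒↭ (unique∧set⇒bag uniqueImage uniqueL sameMembers)
    where
    twice : map g (map g L) ≡ L
    twice = trans (sym (map-∘ L)) (map-id-local (All.tabulate involutive))

    uniqueImage : Unique (map g L)
    uniqueImage = Unique.map⁻ (subst Unique (sym twice) uniqueL)

    sameMembers : map g L ∼[ set ] L
    sameMembers = mk⇔ intoL fromL
      where
      intoL : ∀ {x} → x ∈ map g L → x ∈ L
      intoL x∈ with ∈-map⁻ g x∈
      ... | y , y∈L , refl = into y∈L
      fromL : ∀ {x} → x ∈ L → x ∈ map g L
      fromL x∈L = subst (_∈ map g L) (involutive x∈L) (∈-map⁺ g (into x∈L))

  length-filter-map : ∀ {p q} {P : Pred A p} {Q : Pred A q} (P? : Decidable P) (Q? : Decidable Q)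
                      (g : A → A) (L : List A) → (∀ {x} → x ∈ L → P (g x) ⇔ Q x) →
                      length (filter P? (map g L)) ≡ length (filter Q? L)
  length-filter-map P? Q? g [] P⇔Q = refl
  length-filter-map P? Q? g (x ∷ L) P⇔Q with P? (g x) | Q? x
  ... | yes _  | yes _  = cong suc (length-filter-map P? Q? g L (P⇔Q ∘ there))
  ... | no _   | no _   = length-filter-map P? Q? g L (P⇔Q ∘ there)
  ... | yes Pg | no ¬Q  = ⊥-elim (¬Q (to (P⇔Q (here refl)) Pg))
  ... | no ¬Pg | yes Qx = ⊥-elim (¬Pg (from (P⇔Q (here refl)) Qx))

  count-along-involution : ∀ {p q} {P : Pred A p} {Q : Pred A q} (P? : Decidable P) (Q? : Decidable Q)
                           {L : List A} (g : A → A) → Unique L →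
                           (∀ {x} → x ∈ L → g x ∈ L) → (∀ {x} → x ∈ L → g (g x) ≡ x) →
                           (∀ {x} → x ∈ L → P (g x) ⇔ Q x) →
                           length (filter P? L) ≡ length (filter Q? L)
  count-along-involution P? Q? {L} g uniqueL into involutive P⇔Q = begin
    length (filter P? L)         ≡⟨ ↭-length (filter-↭ P? (↭-sym (involution-↭ g uniqueL into involutive))) ⟩
    length (filter P? (map g L)) ≡⟨ length-filter-map P? Q? g L P⇔Q ⟩
    length (filter Q? L)         ∎
    where open ≡-Reasoning

range : ℕ → List ℕ
range zero    = []
range (suc n) = suc n ∷ range n

∈-range⁻ : ∀ n {z} → z ∈ range n → 1 ≤ z × z ≤ n
∈-range⁻ (suc n) (here refl) = s≤s z≤n , ≤-refl
∈-range⁻ (suc n) (there z∈) = map₂ m≤n⇒m≤1+n (∈-range⁻ n z∈)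

∈-range⁺ : ∀ n {z} → 1 ≤ z → z ≤ n → z ∈ range n
∈-range⁺ zero    {suc _} _ ()
∈-range⁺ (suc n) {z} 1≤z z≤1+n with z ≟ suc n
... | yes refl = here refl
... | no z≢1+n = there (∈-range⁺ n 1≤z (≤-pred (≤∧≢⇒< z≤1+n z≢1+n)))

range-unique : ∀ n → Unique (range n)
range-unique zero    = []
range-unique (suc n) = All.tabulate (λ z∈ 1+n≡z → <-irrefl (sym 1+n≡z) (s≤s (proj₂ (∈-range⁻ n z∈))))
                       ∷ range-unique n

∈-insertions⁻ : ∀ x τ {σ} → σ ∈ insertions x τ → σ ↭ x ∷ τ
∈-insertions⁻ x []       (here refl) = ↭-refl
∈-insertions⁻ x (y ∷ ys) (here refl) = ↭-refl
∈-insertions⁻ x (y ∷ ys) (there σ∈) with ∈-map⁻ (y ∷_) σ∈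
... | σ′ , σ′∈ , refl = ↭-trans (↭-prep y (∈-insertions⁻ x ys σ′∈)) (↭-swap y x ↭-refl)

∈-insertions⁺ : ∀ x a b → a ++ x ∷ b ∈ insertions x (a ++ b)
∈-insertions⁺ x []      []      = here refl
∈-insertions⁺ x []      (y ∷ b) = here refl
∈-insertions⁺ x (y ∷ a) b       = there (∈-map⁺ (y ∷_) (∈-insertions⁺ x a b))

perms-sound : ∀ n {σ} → σ ∈ perms n → σ ↭ range n
perms-sound zero    (here refl) = ↭-refl
perms-sound (suc n) σ∈ with find (∈-concatMap⁻ (insertions (suc n)) {xs = perms n} σ∈)
... | τ , τ∈ , σ∈ins = ↭-trans (∈-insertions⁻ (suc n) τ σ∈ins) (↭-prep (suc n) (perms-sound n τ∈))

perms-complete : ∀ n {σ} → σ ↭ range n → σ ∈ perms n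
perms-complete zero    σ↭ rewrite ↭-empty-inv σ↭ = here refl
perms-complete (suc n) σ↭ with ∈-∃++ (∈-resp-↭ (↭-sym σ↭) (here refl))
... | a , b , refl = ∈-concatMap⁺ (insertions (suc n))
                       (lose (perms-complete n (drop-mid a [] σ↭)) (∈-insertions⁺ (suc n) a b))

perms-letters : ∀ n {σ z} → σ ∈ perms n → z ∈ σ → 1 ≤ z × z ≤ n
perms-letters n σ∈ z∈ = ∈-range⁻ n (∈-resp-↭ (perms-sound n σ∈) z∈)

perms-length : ∀ n {σ} → σ ∈ perms n → length σ ≡ n
perms-length n σ∈ = trans (↭-length (perms-sound n σ∈)) (length-range n)
  where
  length-range : ∀ n → length (range n) ≡ n
  length-range zero    = refl
  length-range (suc n) = cong suc (length-range n)

remove : ℕ → List ℕ → List ℕ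
remove x []       = []
remove x (y ∷ ys) with x ≟ y
... | yes _ = ys
... | no _  = y ∷ remove x ys

remove-head : ∀ x ys → remove x (x ∷ ys) ≡ ys
remove-head x ys with x ≟ x
... | yes _   = refl
... | no x≢x = contradiction refl x≢x

remove-insertion : ∀ x τ {σ} → x ∉ τ → σ ∈ insertions x τ → remove x σ ≡ τ
remove-insertion x []       _   (here refl) = remove-head x []
remove-insertion x (y ∷ ys) _   (here refl) = remove-head x (y ∷ ys)
remove-insertion x (y ∷ ys) x∉τ (there σ∈) with ∈-map⁻ (y ∷_) σ∈
... | σ′ , σ′∈ , refl with x ≟ y
...   | yes refl = contradiction (here refl) x∉τ
...   | no _     = cong (y ∷_) (remove-insertion x ys (x∉τ ∘ there) σ′∈)

insertions-unique : ∀ x τ → x ∉ τ → Unique (insertions x τ)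
insertions-unique x []       _   = [] ∷ []
insertions-unique x (y ∷ ys) x∉τ =
  All.tabulate headDiffers ∷ Unique.map⁺ ∷-injectiveʳ (insertions-unique x ys (x∉τ ∘ there))
  where
  headDiffers : ∀ {σ} → σ ∈ map (y ∷_) (insertions x ys) → x ∷ y ∷ ys ≢ σ
  headDiffers σ∈ eq with ∈-map⁻ (y ∷_) σ∈
  ... | _ , _ , refl = x∉τ (here (∷-injectiveˡ eq))

-- Inserting a new letter x into the words of a duplicate-free list gives a
-- duplicate-free list: an insertion determines its word by removing x again.
insertions-concat-unique : ∀ x {L} → Unique L → (∀ {τ} → τ ∈ L → x ∉ τ) →
                           Unique (concatMap (insertions x) L)
insertions-concat-unique x []                   _     = []
insertions-concat-unique x {τ ∷ L} (τ∉L ∷ uniqueL) fresh =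
  Unique.++⁺ (insertions-unique x τ (fresh (here refl)))
             (insertions-concat-unique x uniqueL (fresh ∘ there))
             disjoint
  where
  disjoint : ∀ {σ} → ¬ (σ ∈ insertions x τ × σ ∈ concatMap (insertions x) L)
  disjoint (σ∈ , σ∈rest) with find (∈-concatMap⁻ (insertions x) {xs = L} σ∈rest)
  ... | τ′ , τ′∈ , σ∈′ = All.lookup τ∉L τ′∈
        (trans (sym (remove-insertion x τ (fresh (here refl)) σ∈))
               (remove-insertion x τ′ (fresh (there τ′∈)) σ∈′))

-- Hence perms n has no repetitions, n + 1 being new in every permutation of [n].
perms-unique : ∀ n → Unique (perms n)
perms-unique zero    = [] ∷ []
perms-unique (suc n) = insertions-concat-unique (suc n) (perms-unique n)
  (λ τ∈ 1+n∈τ → <-irrefl refl (s≤s (proj₂ (perms-letters n τ∈ 1+n∈τ))))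

Pattern21Below : ℕ → List ℕ → Set
Pattern21Below x ys = ∃₂ λ b c → b < x × c < b × (b ∷ c ∷ []) ⊆ ys

Has321 : List ℕ → Set
Has321 σ = ∃ λ a → ∃₂ λ b c → b < a × c < b × (a ∷ b ∷ c ∷ []) ⊆ σ

has21Below⇒ : ∀ x ys → T (has21Below x ys) → Pattern21Below x ys
has21Below⇒ x (y ∷ ys) t with to T-∨ t
... | inj₂ t′ with has21Below⇒ x ys t′
...   | b , c , b<x , c<b , bc⊆ = b , c , b<x , c<b , skip y bc⊆
has21Below⇒ x (y ∷ ys) t | inj₁ t′ with to T-∧ t′
... | y<x , belowY with find (any⁻ (_<ᵇ y) ys belowY)
...   | c , c∈ys , c<y = y , c , <ᵇ⇒< y x y<x , <ᵇ⇒< c y c<y , refl ∷ from∈ c∈ys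

has21Below⇐ : ∀ x ys → Pattern21Below x ys → T (has21Below x ys)
has21Below⇐ x (y ∷ ys) (b , c , b<x , c<b , skip y bc⊆) =
  from T-∨ (inj₂ (has21Below⇐ x ys (b , c , b<x , c<b , bc⊆)))
has21Below⇐ x (y ∷ ys) (b , c , b<x , c<b , refl ∷ c⊆) =
  from T-∨ (inj₁ (from T-∧ (<⇒<ᵇ b<x , any⁺ (_<ᵇ b) (lose (to∈ c⊆) (<⇒<ᵇ c<b)))))

contains321⇒ : ∀ σ → T (contains321 σ) → Has321 σ
contains321⇒ (x ∷ xs) t with to T-∨ t
... | inj₁ t′ with has21Below⇒ x xs t′
...   | b , c , b<x , c<b , bc⊆ = x , b , c , b<x , c<b , refl ∷ bc⊆
contains321⇒ (x ∷ xs) t | inj₂ t′ with contains321⇒ xs t′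
...   | a , b , c , b<a , c<b , abc⊆ = a , b , c , b<a , c<b , skip x abc⊆

contains321⇐ : ∀ σ → Has321 σ → T (contains321 σ)
contains321⇐ (x ∷ xs) (a , b , c , b<a , c<b , skip x abc⊆) =
  from T-∨ (inj₂ (contains321⇐ xs (a , b , c , b<a , c<b , abc⊆)))
contains321⇐ (x ∷ xs) (a , b , c , b<a , c<b , refl ∷ bc⊆) =
  from T-∨ (inj₁ (has21Below⇐ x xs (b , c , b<a , c<b , bc⊆)))

avoids321⇒ : ∀ σ → not (contains321 σ) ≡ true → ¬ Has321 σ
avoids321⇒ σ avoids has321 with contains321 σ | avoids | contains321⇐ σ has321
... | true  | () | _
... | false | _  | ()

avoids321⇐ : ∀ σ → ¬ Has321 σ → not (contains321 σ) ≡ true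
avoids321⇐ σ noPattern with contains321 σ | contains321⇒ σ
... | true  | has321 = ⊥-elim (noPattern (has321 tt))
... | false | _       = refl

rc : ℕ → List ℕ → List ℕ
rc N σ = reverse (map (N ∸_) σ)

Bounded : ℕ → List ℕ → Set
Bounded N = All (_≤ N)

rc-involutive : ∀ N {σ} → Bounded N σ → rc N (rc N σ) ≡ σ
rc-involutive N {σ} bounded = begin
  reverse (map (N ∸_) (reverse (map (N ∸_) σ))) ≡⟨ cong reverse (reverse-map (N ∸_) (map (N ∸_) σ)) ⟩
  reverse (reverse (map (N ∸_) (map (N ∸_) σ))) ≡⟨ reverse-involutive _ ⟩
  map (N ∸_) (map (N ∸_) σ)                     ≡⟨ sym (map-∘ σ) ⟩
  map (λ z → N ∸ (N ∸ z)) σ                     ≡⟨ map-id-local (All.map m∸[m∸n]≡n bounded) ⟩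
  σ                                             ∎
  where open ≡-Reasoning

rc-Has321 : ∀ N {σ} → Bounded N σ → Has321 σ → Has321 (rc N σ)
rc-Has321 N bounded (a , b , c , b<a , c<b , abc⊆) =
  N ∸ c , N ∸ b , N ∸ a ,
  ∸-monoʳ-< c<b (<⇒≤ (<-≤-trans b<a a≤N)) , ∸-monoʳ-< b<a a≤N ,
  reverse⁺ (⊆-map⁺ (N ∸_) abc⊆)
  where
  a≤N : a ≤ N
  a≤N = All.head (All-resp-⊆ abc⊆ bounded)

complement-range : ∀ n → map (suc n ∸_) (range n) ↭ range n
complement-range n = involution-↭ (suc n ∸_) (range-unique n) into involutive
  where
  into : ∀ {z} → z ∈ range n → suc n ∸ z ∈ range n
  into z∈ = let (lo , hi) = ∈-range⁻ n z∈ in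
    ∈-range⁺ n (m<n⇒0<n∸m (s≤s hi)) (∸-monoʳ-≤ (suc n) lo)
  involutive : ∀ {z} → z ∈ range n → suc n ∸ (suc n ∸ z) ≡ z
  involutive z∈ = m∸[m∸n]≡n (m≤n⇒m≤1+n (proj₂ (∈-range⁻ n z∈)))

rc-perms : ∀ n {σ} → σ ∈ perms n → rc (suc n) σ ∈ perms n
rc-perms n {σ} σ∈ = perms-complete n
  (↭-trans (↭-reverse (map (suc n ∸_) σ))
  (↭-trans (↭-map⁺ (suc n ∸_) (perms-sound n σ∈))
           (complement-range n)))

perms-bounded : ∀ n {σ} → σ ∈ perms n → Bounded (suc n) σ
perms-bounded n σ∈ = All.tabulate (m≤n⇒m≤1+n ∘ proj₂ ∘ perms-letters n σ∈)

avoids? : Decidable (λ σ → not (contains321 σ) ≡ true)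
avoids? σ = not (contains321 σ) ≟ᵇ true

∈-Av321⁻ : ∀ n {σ} → σ ∈ Av321 n → σ ∈ perms n × ¬ Has321 σ
∈-Av321⁻ n {σ} σ∈ = map₂ (avoids321⇒ σ) (∈-filter⁻ avoids? {xs = perms n} σ∈)

∈-Av321⁺ : ∀ n {σ} → σ ∈ perms n → ¬ Has321 σ → σ ∈ Av321 n
∈-Av321⁺ n {σ} σ∈ noPattern = ∈-filter⁺ avoids? σ∈ (avoids321⇐ σ noPattern)

Av321-unique : ∀ n → Unique (Av321 n)
Av321-unique n = Unique.filter⁺ avoids? (perms-unique n)

Av321-bounded : ∀ n {σ} → σ ∈ Av321 n → Bounded (suc n) σ
Av321-bounded n = perms-bounded n ∘ proj₁ ∘ ∈-Av321⁻ n

rc-Av321 : ∀ n {σ} → σ ∈ Av321 n → rc (suc n) σ ∈ Av321 n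
rc-Av321 n {σ} σ∈ = ∈-Av321⁺ n rcσ∈perms λ has321 →
  noPattern (subst Has321 (rc-involutive (suc n) (perms-bounded n σ∈perms))
                          (rc-Has321 (suc n) (perms-bounded n rcσ∈perms) has321))
  where
  σ∈perms : σ ∈ perms n
  σ∈perms = proj₁ (∈-Av321⁻ n σ∈)
  noPattern : ¬ Has321 σ
  noPattern = proj₂ (∈-Av321⁻ n σ∈)
  rcσ∈perms : rc (suc n) σ ∈ perms n
  rcσ∈perms = rc-perms n σ∈perms

adjacent : (ℕ → ℕ → Bool) → List ℕ → List Bool
adjacent R []           = []
adjacent R (x ∷ [])     = []
adjacent R (x ∷ y ∷ ys) = R x y ∷ adjacent R (y ∷ ys)

descents : List ℕ → List Bool
descents = adjacent (λ x y → y <ᵇ x)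

bit : Bool → ℕ
bit b = if b then 1 else 0

trues : List Bool → ℕ
trues bs = sum (map bit bs)

positionSum : ℕ → List Bool → ℕ
positionSum i []       = 0
positionSum i (b ∷ bs) = (if b then i else 0) + positionSum (suc i) bs

des-descents : ∀ σ → des σ ≡ trues (descents σ)
des-descents []           = refl
des-descents (x ∷ [])     = refl
des-descents (x ∷ y ∷ ys) = cong (bit (y <ᵇ x) +_) (des-descents (y ∷ ys))

majFrom-descents : ∀ i σ → majFrom i σ ≡ positionSum i (descents σ)
majFrom-descents i []           = refl
majFrom-descents i (x ∷ [])     = refl
majFrom-descents i (x ∷ y ∷ ys) = cong ((if y <ᵇ x then i else 0) +_) (majFrom-descents (suc i) (y ∷ ys))

length-descents : ∀ x xs → length (descents (x ∷ xs)) ≡ length xs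
length-descents x []       = refl
length-descents x (y ∷ ys) = cong suc (length-descents y ys)

adjacent-snoc : ∀ R zs a b → adjacent R ((zs ∷ʳ a) ∷ʳ b) ≡ adjacent R (zs ∷ʳ a) ∷ʳ R a b
adjacent-snoc R []           a b = refl
adjacent-snoc R (z ∷ [])     a b = refl
adjacent-snoc R (z ∷ w ∷ ws) a b = cong (R z w ∷_) (adjacent-snoc R (w ∷ ws) a b)

adjacent-reverse : ∀ R xs → adjacent R (reverse xs) ≡ reverse (adjacent (flip R) xs)
adjacent-reverse R []           = refl
adjacent-reverse R (x ∷ [])     = refl
adjacent-reverse R (x ∷ y ∷ ys) = begin
  adjacent R (reverse (x ∷ y ∷ ys))
    ≡⟨ cong (adjacent R) (trans (unfold-reverse x (y ∷ ys)) (cong (_∷ʳ x) (unfold-reverse y ys))) ⟩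
  adjacent R ((reverse ys ∷ʳ y) ∷ʳ x)
    ≡⟨ adjacent-snoc R (reverse ys) y x ⟩
  adjacent R (reverse ys ∷ʳ y) ∷ʳ R y x
    ≡⟨ cong (λ w → adjacent R w ∷ʳ R y x) (sym (unfold-reverse y ys)) ⟩
  adjacent R (reverse (y ∷ ys)) ∷ʳ R y x
    ≡⟨ cong (_∷ʳ R y x) (adjacent-reverse R (y ∷ ys)) ⟩
  reverse (adjacent (flip R) (y ∷ ys)) ∷ʳ R y x
    ≡⟨ sym (unfold-reverse (R y x) (adjacent (flip R) (y ∷ ys))) ⟩
  reverse (adjacent (flip R) (x ∷ y ∷ ys))
    ∎
  where open ≡-Reasoning

adjacent-map : ∀ {p} {P : Pred ℕ p} (R R′ : ℕ → ℕ → Bool) (f : ℕ → ℕ) →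
               (∀ {x y} → P x → P y → R (f x) (f y) ≡ R′ x y) →
               ∀ {xs} → All P xs → adjacent R (map f xs) ≡ adjacent R′ xs
adjacent-map R R′ f agree []             = refl
adjacent-map R R′ f agree (px ∷ [])      = refl
adjacent-map R R′ f agree (px ∷ py ∷ ps) = cong₂ _∷_ (agree px py) (adjacent-map R R′ f agree (py ∷ ps))

complement-<ᵇ : ∀ {N x y} → x ≤ N → (N ∸ x <ᵇ N ∸ y) ≡ (y <ᵇ x)
complement-<ᵇ {N} {x} {y} x≤N =
  det (<ᵇ-reflects-< (N ∸ x) (N ∸ y)) (fromEquivalence (smaller ∘ <ᵇ⇒< y x) (<⇒<ᵇ ∘ larger))
  where
  smaller : y < x → N ∸ x < N ∸ y
  smaller y<x = ∸-monoʳ-< y<x x≤N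
  larger : N ∸ x < N ∸ y → y < x
  larger lt with y <? x
  ... | yes y<x = y<x
  ... | no y≮x  = contradiction (∸-monoʳ-≤ N (≮⇒≥ y≮x)) (<⇒≱ lt)

descents-rc : ∀ N {σ} → Bounded N σ → descents (rc N σ) ≡ reverse (descents σ)
descents-rc N {σ} bounded = begin
  descents (reverse (map (N ∸_) σ))      ≡⟨ adjacent-reverse _ (map (N ∸_) σ) ⟩
  reverse (adjacent _<ᵇ_ (map (N ∸_) σ)) ≡⟨ cong reverse (adjacent-map _<ᵇ_ _ (N ∸_) (λ x≤N _ → complement-<ᵇ x≤N) bounded) ⟩
  reverse (descents σ)                   ∎
  where open ≡-Reasoning

trues-reverse : ∀ bs → trues (reverse bs) ≡ trues bs
trues-reverse bs = sum-↭ (↭-map⁺ bit (↭-reverse bs))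

positionSum-suc : ∀ i bs → positionSum (suc i) bs ≡ positionSum i bs + trues bs
positionSum-suc i []           = refl
positionSum-suc i (false ∷ bs) = positionSum-suc (suc i) bs
positionSum-suc i (true ∷ bs)  = begin
  suc i + positionSum (suc (suc i)) bs       ≡⟨ cong (suc i +_) (positionSum-suc (suc i) bs) ⟩
  suc i + (positionSum (suc i) bs + trues bs) ≡⟨ regroup i (positionSum (suc i) bs) (trues bs) ⟩
  (i + positionSum (suc i) bs) + (1 + trues bs) ∎
  where
  open ≡-Reasoning
  regroup : ∀ i P t → suc i + (P + t) ≡ (i + P) + (1 + t)
  regroup = solve-∀

positionSum-snoc : ∀ i bs b → positionSum i (bs ∷ʳ b) ≡ positionSum i bs + (if b then i + length bs else 0)
positionSum-snoc i []       true  = refl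
positionSum-snoc i []       false = refl
positionSum-snoc i (c ∷ bs) b     = begin
  first + positionSum (suc i) (bs ∷ʳ b)
    ≡⟨ cong (first +_) (positionSum-snoc (suc i) bs b) ⟩
  first + (positionSum (suc i) bs + (if b then suc i + length bs else 0))
    ≡⟨ sym (+-assoc first _ _) ⟩
  (first + positionSum (suc i) bs) + (if b then suc i + length bs else 0)
    ≡⟨ cong (λ x → (first + positionSum (suc i) bs) + (if b then x else 0)) (sym (+-suc i (length bs))) ⟩
  (first + positionSum (suc i) bs) + (if b then i + suc (length bs) else 0)
    ∎
  where
  open ≡-Reasoning
  first : ℕ
  first = if c then i else 0

if-as-bit : ∀ b x → (if b then x else 0) ≡ bit b * x
if-as-bit true  x = sym (+-identityʳ x)
if-as-bit false x = refl

-- Mirror identity: position p in bs is position l + 1 − p in reverse bs, so the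
-- position sums of a word of length l and its reverse add up to (l + 1)·#trues.
positionSum-reverse : ∀ bs → positionSum 1 (reverse bs) + positionSum 1 bs ≡ suc (length bs) * trues bs
positionSum-reverse []       = refl
positionSum-reverse (b ∷ bs) = begin
  positionSum 1 (reverse (b ∷ bs)) + positionSum 1 (b ∷ bs)
    ≡⟨ cong₂ _+_ backwards forwards ⟩
  (R + bit b * suc l) + (bit b + (P + t))
    ≡⟨ step R P t l (bit b) (positionSum-reverse bs) ⟩
  suc (suc l) * (bit b + t)
    ∎
  where
  open ≡-Reasoning
  R P t l : ℕ
  R = positionSum 1 (reverse bs)
  P = positionSum 1 bs
  t = trues bs
  l = length bs

  backwards : positionSum 1 (reverse (b ∷ bs)) ≡ R + bit b * suc l
  backwards = begin
    positionSum 1 (reverse (b ∷ bs))                           ≡⟨ cong (positionSum 1) (unfold-reverse b bs) ⟩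
    positionSum 1 (reverse bs ∷ʳ b)                            ≡⟨ positionSum-snoc 1 (reverse bs) b ⟩
    R + (if b then suc (length (reverse bs)) else 0)           ≡⟨ cong (R +_) (if-as-bit b _) ⟩
    R + bit b * suc (length (reverse bs))                      ≡⟨ cong (λ m → R + bit b * suc m) (length-reverse bs) ⟩
    R + bit b * suc l                                          ∎

  forwards : positionSum 1 (b ∷ bs) ≡ bit b + (P + t)
  forwards = cong (bit b +_) (positionSum-suc 1 bs)

  step : ∀ R P t l c → R + P ≡ suc l * t → (R + c * suc l) + (c + (P + t)) ≡ suc (suc l) * (c + t)
  step R P t l c R+P≡ = begin
    (R + c * suc l) + (c + (P + t))     ≡⟨ regroup R P t l c ⟩
    (R + P) + (t + c * suc (suc l))     ≡⟨ cong (_+ (t + c * suc (suc l))) R+P≡ ⟩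
    suc l * t + (t + c * suc (suc l))   ≡⟨ collect t l c ⟩
    suc (suc l) * (c + t)               ∎
    where
    regroup : ∀ R P t l c → (R + c * suc l) + (c + (P + t)) ≡ (R + P) + (t + c * suc (suc l))
    regroup = solve-∀
    collect : ∀ t l c → suc l * t + (t + c * suc (suc l)) ≡ suc (suc l) * (c + t)
    collect = solve-∀

des-rc : ∀ N {σ} → Bounded N σ → des (rc N σ) ≡ des σ
des-rc N {σ} bounded = begin
  des (rc N σ)                 ≡⟨ des-descents (rc N σ) ⟩
  trues (descents (rc N σ))    ≡⟨ cong trues (descents-rc N bounded) ⟩
  trues (reverse (descents σ)) ≡⟨ trues-reverse (descents σ) ⟩
  trues (descents σ)           ≡⟨ sym (des-descents σ) ⟩
  des σ                        ∎
  where open ≡-Reasoning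

maj-rc : ∀ N {σ} → Bounded N σ → maj (rc N σ) + maj σ ≡ length σ * des σ
maj-rc N {σ} bounded = begin
  maj (rc N σ) + maj σ
    ≡⟨ cong₂ _+_ (majFrom-descents 1 (rc N σ)) (majFrom-descents 1 σ) ⟩
  positionSum 1 (descents (rc N σ)) + positionSum 1 (descents σ)
    ≡⟨ cong (λ w → positionSum 1 w + positionSum 1 (descents σ)) (descents-rc N bounded) ⟩
  positionSum 1 (reverse (descents σ)) + positionSum 1 (descents σ)
    ≡⟨ positionSum-reverse (descents σ) ⟩
  suc (length (descents σ)) * trues (descents σ)
    ≡⟨ word-length σ ⟩
  length σ * des σ
    ∎
  where
  open ≡-Reasoning
  word-length : ∀ σ → suc (length (descents σ)) * trues (descents σ) ≡ length σ * des σ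
  word-length []       = refl
  word-length (x ∷ xs) = cong₂ _*_ (cong suc (length-descents x xs)) (sym (des-descents (x ∷ xs)))

maj-rc-Av321 : ∀ n {σ} → σ ∈ Av321 n → maj (rc (suc n) σ) + maj σ ≡ n * des σ
maj-rc-Av321 n {σ} σ∈ = trans (maj-rc (suc n) (Av321-bounded n σ∈)) 
  (cong (_* des σ) (perms-length n (proj₁ (∈-Av321⁻ n σ∈))))

Match : ℕ → ℕ → List ℕ → Set
Match k m σ = des σ ≡ k × maj σ ≡ m

match? : ∀ k m → Decidable (Match k m)
match? k m σ = (des σ ≟ k) ×-dec (maj σ ≟ m)

A-coeff-count : ∀ n k m → A-coeff n k m ≡ length (filter (match? k m) (Av321 n))
A-coeff-count n k m = cong length (filter-≐ flagged? (match? k m) flagged≐match (Av321 n))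
  where
  Flagged : List ℕ → Set
  Flagged σ = ((des σ ≡ᵇ k) ∧ (maj σ ≡ᵇ m)) ≡ true
  flagged? : Decidable Flagged
  flagged? σ = ((des σ ≡ᵇ k) ∧ (maj σ ≡ᵇ m)) ≟ᵇ true
  flagged⇒ : ∀ σ → Flagged σ → Match k m σ
  flagged⇒ σ flag with to T-∧ (from T-≡ flag)
  ... | d , j = ≡ᵇ⇒≡ (des σ) k d , ≡ᵇ⇒≡ (maj σ) m j
  ⇒flagged : ∀ σ → Match k m σ → Flagged σ
  ⇒flagged σ (d , j) = to T-≡ (from T-∧ (≡⇒≡ᵇ (des σ) k d , ≡⇒≡ᵇ (maj σ) m j))
  flagged≐match : Flagged ≐ Match k m
  flagged≐match = (λ {σ} → flagged⇒ σ) , (λ {σ} → ⇒flagged σ)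

sum-complement : ∀ {a b T m} → a + b ≡ T → m ≤ T → a ≡ m ⇔ b ≡ T ∸ m
sum-complement {a} {b} {T} {m} a+b≡T m≤T = mk⇔ forward backward
  where
  forward : a ≡ m → b ≡ T ∸ m
  forward refl = trans (sym (m+n∸m≡n a b)) (cong (_∸ a) a+b≡T)
  backward : b ≡ T ∸ m → a ≡ m
  backward refl = trans (sym (m+n∸n≡m a b)) (trans (cong (_∸ (T ∸ m)) a+b≡T) (m∸[m∸n]≡n m≤T))

match-rc : ∀ n k m {σ} → σ ∈ Av321 n → m ≤ n * k → Match k m (rc (suc n) σ) ⇔ Match k (n * k ∸ m) σ
match-rc n k m {σ} σ∈ m≤nk = mk⇔ forward backward
  where
  des≡ : des (rc (suc n) σ) ≡ des σ
  des≡ = des-rc (suc n) (Av321-bounded n σ∈)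
  majs : des σ ≡ k → maj (rc (suc n) σ) + maj σ ≡ n * k
  majs refl = maj-rc-Av321 n σ∈
  forward : Match k m (rc (suc n) σ) → Match k (n * k ∸ m) σ
  forward (d , j) = trans (sym des≡) d , to (sum-complement (majs (trans (sym des≡) d)) m≤nk) j
  backward : Match k (n * k ∸ m) σ → Match k m (rc (suc n) σ)
  backward (d , j) = trans des≡ d , from (sum-complement (majs d) m≤nk) j

-- Since maj σ ≤ n · des σ on Av321 n, nothing there matches (k, m) with m > n·k.
no-match-above : ∀ n k m {σ} → σ ∈ Av321 n → n * k < m → ¬ Match k m σ
no-match-above n k m {σ} σ∈ nk<m (refl , refl) =
  <⇒≱ nk<m (≤-trans (m≤n+m (maj σ) (maj (rc (suc n) σ))) (≤-reflexive (maj-rc-Av321 n σ∈)))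

coeff-reflect : ∀ n k m → m ≤ n * k → A-coeff n k m ≡ A-coeff n k (n * k ∸ m)
coeff-reflect n k m m≤nk = begin
  A-coeff n k m                                    ≡⟨ A-coeff-count n k m ⟩
  length (filter (match? k m) (Av321 n))           ≡⟨ count-along-involution (match? k m) (match? k (n * k ∸ m))
                                                        (rc (suc n)) (Av321-unique n) (rc-Av321 n)
                                                        (rc-involutive (suc n) ∘ Av321-bounded n)
                                                        (λ σ∈ → match-rc n k m σ∈ m≤nk) ⟩
  length (filter (match? k (n * k ∸ m)) (Av321 n)) ≡⟨ sym (A-coeff-count n k (n * k ∸ m)) ⟩
  A-coeff n k (n * k ∸ m)                          ∎
  where open ≡-Reasoning

coeff-vanish : ∀ n k m → n * k < m → A-coeff n k m ≡ 0
coeff-vanish n k m nk<m = trans (A-coeff-count n k m)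
  (cong length (filter-none (match? k m) (All.tabulate (λ σ∈ → no-match-above n k m σ∈ nk<m))))

-- A coefficient sequence vanishing beyond T and invariant under m ↦ T − m is
-- symmetric: its lowest and highest nonzero indices r and s satisfy r + s = T.
reflection⇒symmetric : ∀ (f : ℕ → ℕ) T → (∀ m → m ≤ T → f m ≡ f (T ∸ m)) →
                       (∀ m → T < m → f m ≡ 0) → Symmetric f
reflection⇒symmetric f T reflect vanish r s fr≢0 fs≢0 belowR aboveS i j i+j≡r+s = begin
  f i       ≡⟨ reflect i i≤T ⟩
  f (T ∸ i) ≡⟨ cong f (sym j≡T∸i) ⟩
  f j       ∎
  where
  open ≡-Reasoning
  support : ∀ {x} → f x ≢ 0 → x ≤ T
  support fx≢0 = ≮⇒≥ (fx≢0 ∘ vanish _)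
  r≤T∸s : r ≤ T ∸ s
  r≤T∸s = ≮⇒≥ (λ T∸s<r → fs≢0 (trans (reflect s (support fs≢0)) (belowR (T ∸ s) T∸s<r)))
  T∸r≤s : T ∸ r ≤ s
  T∸r≤s = ≮⇒≥ (λ s<T∸r → fr≢0 (trans (reflect r (support fr≢0)) (aboveS (T ∸ r) s<T∸r)))
  r+s≡T : r + s ≡ T
  r+s≡T = ≤-antisym (≤-trans (+-monoˡ-≤ s r≤T∸s) (≤-reflexive (m∸n+n≡m (support fs≢0))))
                    (≤-trans (≤-reflexive (sym (m+[n∸m]≡n (support fr≢0)))) (+-monoʳ-≤ r T∸r≤s))
  i+j≡T : i + j ≡ T
  i+j≡T = trans i+j≡r+s r+s≡T
  i≤T : i ≤ T
  i≤T = subst (i ≤_) i+j≡T (m≤m+n i j)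
  j≡T∸i : j ≡ T ∸ i
  j≡T∸i = trans (sym (m+n∸m≡n i j)) (cong (_∸ i) i+j≡T)

theorem7p1 : (n k : ℕ) → n ≥ 1 → Nonzero (A-coeff n k) → Symmetric (A-coeff n k)
theorem7p1 n k _ _ = reflection⇒symmetric (A-coeff n k) (n * k) (coeff-reflect n k) (coeff-vanish n k)
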